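{- Consider an altered Wythoff game and let $t_0$ be a natural column such that every column $t\ge t_0$ is saturated. Then for every $t\ge t_0+1$, applying the Wythoff Update to $S_{t-1}$ gives $S_t$.
   Context: Wythoff's game: a position is a pair $(x,y)$ of non-negative integers ($x$ = column, $y$ = row). A move from $(x,y)$ goes to $(x-k,y)$, $(x,y-k)$ or $(x-k,y-k)$ for some integer $k\ge1$, with non-negative result. An altered Wythoff game is given by finite disjoint sets $\mathcal{P},\mathcal{N}\subset\mathbb{Z}_{\ge0}^2$; positions are labelled by recursion on $x+y$: positions in $\mathcal{P}$ are P, positions in $\mathcal{N}$ are N, any other position is P if no position reachable in one move is labelled P, and N otherwise. Fix $m_x$ such that every element of $\mathcal{P}\cup\mathcal{N}$ has first coordinate $<m_x$; a column $t$ is natural if $t\ge m_x$. For a column $t$ and integer $y\ge0$: $\mathrm{row}_t[y]$ is TRUE iff there is a P-position $(x',y)$ with $x'\le t$; $\mathrm{diag}_t[y]$ is TRUE iff the diagonal $\{(t-k,y-k):k\ge0\}$ contains a P-position. $\ell_t$ is the minimum and $u_t$ the maximum $y$ with $\mathrm{diag}_t[y]$ TRUE. Column $t$ is saturated if $\mathrm{diag}_t[y]$ is TRUE iff $\ell_t\le y\le u_t$. $S_t$ is the binary string $\mathrm{row}_t[\ell_t]\,\mathrm{row}_t[\ell_t+1]\cdots\mathrm{row}_t[u_t]$ with TRUE written as $1$ and FALSE as $0$. The Wythoff Update of a non-empty binary string $S$: if the first character is $0$, change it to $1$ and append $0$ at the right end; if the first character is $1$, remove it and append $01$ at the right end. 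-}

module Defs where

open import Data.Nat using (ℕ; zero; suc; _+_; _∸_; _≤_; _<_)
open import Data.Bool using (Bool; true; false; _∨_)
open import Data.Product using (Σ; _×_; _,_)
open import Data.Sum using (_⊎_)
open import Data.List using (List; []; _∷_; _++_; map; upTo)
open import Data.List.Membership.Propositional using (_∈_; _∉_)
open import Relation.Nullary using (¬_)
open import Relation.Binary.PropositionalEquality using (_≡_)
open import Function.Bundles using (_⇔_)

-- A position (x , y): x = column, y = row.
Pos : Set
Pos = ℕ × ℕ

-- A labelling: lab x y ≡ true means (x , y) is a P-position, false means N.
Labelling : Set
Labelling = ℕ → ℕ → Bool

MoveToP : Labelling → ℕ → ℕ → Set
MoveToP lab x y =
    (Σ ℕ λ k → (1 ≤ k) × (k ≤ x) × (lab (x ∸ k) y ≡ true))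
  ⊎ (Σ ℕ λ k → (1 ≤ k) × (k ≤ y) × (lab x (y ∸ k) ≡ true))
  ⊎ (Σ ℕ λ k → (1 ≤ k) × (k ≤ x) × (k ≤ y) × (lab (x ∸ k) (y ∸ k) ≡ true))

-- lab is the labelling of the altered Wythoff game with forced sets Ps (P) and Ns (N):
-- it satisfies the defining recursion at every position (this determines lab uniquely).
IsAlteredWythoffLabelling : List Pos → List Pos → Labelling → Set
IsAlteredWythoffLabelling Ps Ns lab =
  ∀ x y → (lab x y ≡ true) ⇔ (((x , y) ∈ Ps) ⊎ (((x , y) ∉ Ns) × ¬ MoveToP lab x y))

row : Labelling → ℕ → ℕ → Bool
row lab zero y = lab zero y
row lab (suc t) y = lab (suc t) y ∨ row lab t y

-- diag_t[y] : the diagonal {(t-k , y-k) : k ≥ 0} (within the quadrant) contains a P-position.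
diag : Labelling → ℕ → ℕ → Bool
diag lab zero y = lab zero y
diag lab (suc t) zero = lab (suc t) zero
diag lab (suc t) (suc y) = lab (suc t) (suc y) ∨ diag lab t y

IsLow : Labelling → ℕ → ℕ → Set
IsLow lab t ℓ = (diag lab t ℓ ≡ true) × (∀ y → diag lab t y ≡ true → ℓ ≤ y)

IsUp : Labelling → ℕ → ℕ → Set
IsUp lab t u = (diag lab t u ≡ true) × (∀ y → diag lab t y ≡ true → y ≤ u)

Saturated : Labelling → ℕ → Set
Saturated lab t = Σ ℕ λ ℓ → Σ ℕ λ u → IsLow lab t ℓ × IsUp lab t u
  × (∀ y → (diag lab t y ≡ true) ⇔ ((ℓ ≤ y) × (y ≤ u)))

-- S_t = row_t[ℓ] row_t[ℓ+1] ... row_t[u]  (true = 1, false = 0).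
Sstr : Labelling → ℕ → ℕ → ℕ → List Bool
Sstr lab t ℓ u = map (λ i → row lab t (ℓ + i)) (upTo (suc (u ∸ ℓ)))

-- The Wythoff Update (on non-empty strings; the empty string is left unchanged).
wythoffUpdate : List Bool → List Bool
wythoffUpdate [] = []
wythoffUpdate (false ∷ s) = true ∷ (s ++ (false ∷ []))
wythoffUpdate (true ∷ s) = s ++ (false ∷ true ∷ [])

-- Column t = s + 1 is natural, so (t , y) is a P-position exactly when no move from it reaches one.
-- A vertical move joins any two P-positions of a column, so column t holds a single P-position p,
-- and diag_t is diag_s shifted up by one row together with p.  Saturation of column t forbids p < ℓ_s,
-- so p sits at the first row not blocked horizontally (by row_s) or diagonally (by diag_s): p = ℓ_s
-- when row_s[ℓ_s] = 0, and p = u_s + 2 otherwise.  This gives [ℓ_t , u_t] = [ℓ_s , u_s + 1],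
-- resp. [ℓ_s + 1 , u_s + 2], and row_t agrees with row_s except at p, which is the Wythoff Update.
module Submission where

open import Defs
open import Data.Nat using (ℕ; zero; suc; _+_; _≤_; _<_; _∸_; z≤n; s≤s)
open import Data.Nat.Properties
open import Data.Bool using (Bool; true; false; _∨_)
open import Data.Bool.Properties using (∨-zeroʳ; ¬-not; not-¬)
open import Data.Product using (Σ; _×_; _,_; proj₁; proj₂)
open import Data.Sum using (_⊎_; inj₁; inj₂)
open import Data.List using (List; []; _∷_; _++_; [_]; applyUpTo)
open import Data.List.Properties using (map-upTo; ++-assoc)
open import Data.List.Membership.Propositional using (_∈_; _∉_)
open import Relation.Nullary using (¬_; contradiction)
open import Relation.Binary using (tri<; tri≈; tri>)
open import Relation.Binary.PropositionalEquality hiding ([_])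
open import Function.Base using (case_of_)
open import Function.Bundles using (Equivalence)

∨-introʳ : ∀ a {b} → b ≡ true → a ∨ b ≡ true
∨-introʳ a b≡true = trans (cong (a ∨_) b≡true) (∨-zeroʳ a)

segment : {A : Set} → (ℕ → A) → ℕ → ℕ → List A
segment f a zero    = []
segment f a (suc n) = f a ∷ segment f (suc a) n

applyUpTo≡segment : {A : Set} (g f : ℕ → A) (a n : ℕ) → (∀ i → g i ≡ f (a + i))
  → applyUpTo g n ≡ segment f a n
applyUpTo≡segment g f a zero    g≗ = refl
applyUpTo≡segment g f a (suc n) g≗ =
  cong₂ _∷_ (trans (g≗ 0) (cong f (+-identityʳ a)))
    (applyUpTo≡segment (λ i → g (suc i)) f (suc a) n
      (λ i → trans (g≗ (suc i)) (cong f (+-suc a i))))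

segment-∷ʳ : {A : Set} (f : ℕ → A) (a n : ℕ) → segment f a (suc n) ≡ segment f a n ++ [ f (a + n) ]
segment-∷ʳ f a zero    = cong (λ i → [ f i ]) (sym (+-identityʳ a))
segment-∷ʳ f a (suc n) = cong (f a ∷_) (begin
    segment f (suc a) (suc n)               ≡⟨ segment-∷ʳ f (suc a) n ⟩
    segment f (suc a) n ++ [ f (suc a + n) ] ≡⟨ cong (λ i → segment f (suc a) n ++ [ f i ]) (sym (+-suc a n)) ⟩
    segment f (suc a) n ++ [ f (a + suc n) ] ∎)
  where open ≡-Reasoning

segment-cong : {A : Set} {f g : ℕ → A} (a n : ℕ) → (∀ i → a ≤ i → i < a + n → f i ≡ g i)
  → segment f a n ≡ segment g a n
segment-cong a zero    f≗g = refl
segment-cong a (suc n) f≗g =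
  cong₂ _∷_ (f≗g a ≤-refl (m<m+n a (s≤s z≤n)))
    (segment-cong (suc a) n λ i a<i i<end →
      f≗g i (<⇒≤ a<i) (subst (i <_) (sym (+-suc a n)) i<end))

Sstr≡segment : ∀ lab t ℓ u {m} → u ∸ ℓ ≡ m → Sstr lab t ℓ u ≡ segment (row lab t) ℓ (suc m)
Sstr≡segment lab t ℓ u refl =
  trans (map-upTo _ (suc (u ∸ ℓ))) (applyUpTo≡segment _ (row lab t) ℓ _ (λ _ → refl))

module _ {f g : ℕ → Bool} {a n : ℕ} (f≗g : ∀ i → a < i → i ≤ a + n → f i ≡ g i) where
  open ≡-Reasoning

  private
    tail-cong : segment f (suc a) n ≡ segment g (suc a) n
    tail-cong = segment-cong (suc a) n λ i a<i i<end → f≗g i a<i (≤-pred i<end)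

  wythoffUpdate-segment-false : f a ≡ false → g a ≡ true → g (suc a + n) ≡ false
    → wythoffUpdate (segment f a (suc n)) ≡ segment g a (suc (suc n))
  wythoffUpdate-segment-false fa ga g-end = begin
    wythoffUpdate (f a ∷ segment f (suc a) n)          ≡⟨ cong (λ b → wythoffUpdate (b ∷ segment f (suc a) n)) fa ⟩
    true ∷ (segment f (suc a) n ++ [ false ])            ≡⟨ cong₂ (λ xs b → true ∷ (xs ++ [ b ])) tail-cong (sym g-end) ⟩
    true ∷ (segment g (suc a) n ++ [ g (suc a + n) ])    ≡⟨ cong₂ _∷_ (sym ga) (sym (segment-∷ʳ g (suc a) n)) ⟩
    segment g a (suc (suc n))                            ∎

  wythoffUpdate-segment-true : f a ≡ true → g (suc a + n) ≡ false → g (suc a + suc n) ≡ true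
    → wythoffUpdate (segment f a (suc n)) ≡ segment g (suc a) (suc (suc n))
  wythoffUpdate-segment-true fa g-end g-top = begin
    wythoffUpdate (f a ∷ segment f (suc a) n)  ≡⟨ cong (λ b → wythoffUpdate (b ∷ segment f (suc a) n)) fa ⟩
    segment f (suc a) n ++ false ∷ true ∷ []     ≡⟨ cong₂ _++_ tail-cong (cong₂ (λ b c → b ∷ c ∷ []) (sym g-end) (sym g-top)) ⟩
    segment g (suc a) n ++ [ x ] ++ [ y ]        ≡⟨ ++-assoc (segment g (suc a) n) [ x ] [ y ] ⟨
    (segment g (suc a) n ++ [ x ]) ++ [ y ]      ≡⟨ cong (_++ [ y ]) (segment-∷ʳ g (suc a) n) ⟨
    segment g (suc a) (suc n) ++ [ y ]           ≡⟨ segment-∷ʳ g (suc a) (suc n) ⟨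
    segment g (suc a) (suc (suc n))              ∎
    where
    x = g (suc a + n)
    y = g (suc a + suc n)

module _ (lab : Labelling) where

  P⇒diag : ∀ t y → lab t y ≡ true → diag lab t y ≡ true
  P⇒diag zero    y       Pty = Pty
  P⇒diag (suc t) zero    Pty = Pty
  P⇒diag (suc t) (suc y) Pty = cong (_∨ diag lab t y) Pty

  row-intro : ∀ t k y → k ≤ t → lab (t ∸ k) y ≡ true → row lab t y ≡ true
  row-intro zero    zero    y _         P = P
  row-intro (suc t) zero    y _         P = cong (_∨ row lab t y) P
  row-intro (suc t) (suc k) y (s≤s k≤t) P = ∨-introʳ _ (row-intro t k y k≤t P)

  row-elim : ∀ t y → row lab t y ≡ true → Σ ℕ λ k → k ≤ t × lab (t ∸ k) y ≡ true
  row-elim zero    y r = 0 , z≤n , r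
  row-elim (suc t) y r with lab (suc t) y in P
  ... | true  = 0 , z≤n , P
  ... | false with row-elim t y r
  ...   | k , k≤t , P′ = suc k , s≤s k≤t , P′

  diag-intro : ∀ t k y → k ≤ t → k ≤ y → lab (t ∸ k) (y ∸ k) ≡ true → diag lab t y ≡ true
  diag-intro t       zero    y       _         _         P = P⇒diag t y P
  diag-intro (suc t) (suc k) (suc y) (s≤s k≤t) (s≤s k≤y) P = ∨-introʳ _ (diag-intro t k y k≤t k≤y P)

  diag-elim : ∀ t y → diag lab t y ≡ true → Σ ℕ λ k → k ≤ t × k ≤ y × lab (t ∸ k) (y ∸ k) ≡ true
  diag-elim zero    y       d = 0 , z≤n , z≤n , d
  diag-elim (suc t) zero    d = 0 , z≤n , z≤n , d
  diag-elim (suc t) (suc y) d with lab (suc t) (suc y) in P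
  ... | true  = 0 , z≤n , z≤n , P
  ... | false with diag-elim t y d
  ...   | k , k≤t , k≤y , P′ = suc k , s≤s k≤t , s≤s k≤y , P′

  diag-suc-elim : ∀ t y → diag lab (suc t) y ≡ true
    → lab (suc t) y ≡ true ⊎ Σ ℕ λ y′ → y ≡ suc y′ × diag lab t y′ ≡ true
  diag-suc-elim t zero    d = inj₁ d
  diag-suc-elim t (suc y) d with lab (suc t) (suc y)
  ... | true  = inj₁ refl
  ... | false = inj₂ (y , refl , d)

  row-suc-of-N : ∀ t y → lab (suc t) y ≡ false → row lab (suc t) y ≡ row lab t y
  row-suc-of-N t y N = cong (_∨ row lab t y) N

  row⇒≤up : ∀ t {u y} → IsUp lab t u → row lab t y ≡ true → y ≤ u
  row⇒≤up t {u} {y} (_ , below-u) r with row-elim t y r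
  ... | k , k≤t , P = ≤-trans (m≤m+n y k) (below-u (y + k) (diag-intro t k (y + k) k≤t (m≤n+m k y)
        (subst (λ z → lab (t ∸ k) z ≡ true) (sym (m+n∸n≡m y k)) P)))

  IsLow-unique : ∀ t {a b} → IsLow lab t a → IsLow lab t b → a ≡ b
  IsLow-unique t (da , a≤) (db , b≤) = ≤-antisym (a≤ _ db) (b≤ _ da)

  IsUp-unique : ∀ t {a b} → IsUp lab t a → IsUp lab t b → a ≡ b
  IsUp-unique t (da , ≤a) (db , ≤b) = ≤-antisym (≤b _ da) (≤a _ db)

  Saturated⇒convex : ∀ t {a b y} → Saturated lab t → diag lab t a ≡ true → diag lab t b ≡ true
    → a ≤ y → y ≤ b → diag lab t y ≡ true
  Saturated⇒convex t {a} {b} {y} (_ , _ , _ , _ , band) da db a≤y y≤b =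
    Equivalence.from (band y)
      ( ≤-trans (proj₁ (Equivalence.to (band a) da)) a≤y
      , ≤-trans y≤b (proj₂ (Equivalence.to (band b) db)))

module NaturalColumn (Ps Ns : List Pos) (lab : Labelling) (isLab : IsAlteredWythoffLabelling Ps Ns lab)
  (s : ℕ) (∉Ps : ∀ y → (suc s , y) ∉ Ps) (∉Ns : ∀ y → (suc s , y) ∉ Ns) where

  P⇒noMoveToP : ∀ y → lab (suc s) y ≡ true → ¬ MoveToP lab (suc s) y
  P⇒noMoveToP y P with Equivalence.to (isLab (suc s) y) P
  ... | inj₁ forced      = contradiction forced (∉Ps y)
  ... | inj₂ (_ , noMove) = noMove

  P-intro : ∀ y → row lab s y ≡ false → (∀ y′ → y ≡ suc y′ → diag lab s y′ ≡ false)
    → (∀ y′ → y′ < y → lab (suc s) y′ ≡ false) → lab (suc s) y ≡ true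
  P-intro y row-free diag-free below-free =
    Equivalence.from (isLab (suc s) y) (inj₂ (∉Ns y , noMove))
    where
    noMove : ¬ MoveToP lab (suc s) y
    noMove (inj₁ (suc k , _ , s≤s k≤s , P)) = not-¬ (row-intro lab s k y k≤s P) row-free
    noMove (inj₂ (inj₁ (k , 1≤k , k≤y , P))) =
      not-¬ P (below-free (y ∸ k) (∸-monoʳ-< {y} {k} {0} 1≤k k≤y))
    noMove (inj₂ (inj₂ (suc k , _ , s≤s k≤s , s≤s {n = y′} k≤y′ , P))) =
      not-¬ (diag-intro lab s k y′ k≤s k≤y′ P) (diag-free y′ refl)

  row⇒N : ∀ y → row lab s y ≡ true → lab (suc s) y ≡ false
  row⇒N y r = ¬-not λ P → case row-elim lab s y r of λ where
    (k , k≤s , P′) → P⇒noMoveToP y P (inj₁ (suc k , s≤s z≤n , s≤s k≤s , P′))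

  diag⇒N : ∀ y → diag lab s y ≡ true → lab (suc s) (suc y) ≡ false
  diag⇒N y d = ¬-not λ P → case diag-elim lab s y d of λ where
    (k , k≤s , k≤y , P′) → P⇒noMoveToP (suc y) P (inj₂ (inj₂ (suc k , s≤s z≤n , s≤s k≤s , s≤s k≤y , P′)))

  P-below-P : ∀ {a b} → a < b → lab (suc s) a ≡ true → lab (suc s) b ≢ true
  P-below-P {a} {b} a<b Pa Pb = P⇒noMoveToP b Pb (inj₂ (inj₁ (b ∸ a , m<n⇒0<n∸m a<b , m∸n≤m b a ,
    subst (λ z → lab (suc s) z ≡ true) (sym (m∸[m∸n]≡n (<⇒≤ a<b))) Pa)))

  P-unique : ∀ {a b} → lab (suc s) a ≡ true → lab (suc s) b ≡ true → a ≡ b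
  P-unique {a} {b} Pa Pb with <-cmp a b
  ... | tri< a<b _ _ = contradiction Pb (P-below-P a<b Pa)
  ... | tri≈ _ a≡b _ = a≡b
  ... | tri> _ _ b<a = contradiction Pa (P-below-P b<a Pb)

  module _ (sat-s : Saturated lab s) (sat-t : Saturated lab (suc s))
           {ℓ′ u′ : ℕ} (low′ : IsLow lab s ℓ′) (up′ : IsUp lab s u′) where

    ℓ′≤u′ : ℓ′ ≤ u′
    ℓ′≤u′ = proj₂ up′ ℓ′ (proj₁ low′)

    diag-band : ∀ y → ℓ′ ≤ y → y ≤ u′ → diag lab s y ≡ true
    diag-band y = Saturated⇒convex lab s sat-s (proj₁ low′) (proj₁ up′)

    row-above-u′ : ∀ y → u′ < y → row lab s y ≡ false
    row-above-u′ y u′<y = ¬-not λ r → <⇒≱ u′<y (row⇒≤up lab s up′ r)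

    -- A P-position at y < ℓ′ would make diag_t true at y and at ℓ′ + 1, hence, by saturation,
    -- at ℓ′; but diag_s is false at ℓ′ − 1 and (t , ℓ′) is a second P-position of column t.
    N-below-ℓ′ : ∀ y → y < ℓ′ → lab (suc s) y ≡ false
    N-below-ℓ′ y y<ℓ′ = ¬-not λ Py →
      case diag-suc-elim lab s ℓ′ (Saturated⇒convex lab (suc s) sat-t (P⇒diag lab (suc s) y Py)
             (∨-introʳ _ (proj₁ low′)) (<⇒≤ y<ℓ′) (n≤1+n ℓ′)) of λ where
        (inj₁ Pℓ′)                → <⇒≢ y<ℓ′ (P-unique Py Pℓ′)
        (inj₂ (y′ , refl , d))  → n≮n y′ (proj₂ low′ y′ d)

    N-inside : ∀ y → ℓ′ < y → y ≤ suc u′ → lab (suc s) y ≡ false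
    N-inside (suc y) (s≤s ℓ′≤y) (s≤s y≤u′) = diag⇒N y (diag-band y ℓ′≤y y≤u′)

    P-at-ℓ′ : row lab s ℓ′ ≡ false → lab (suc s) ℓ′ ≡ true
    P-at-ℓ′ row-free = P-intro ℓ′ row-free
      (λ y′ ℓ′≡ → ¬-not λ d → n≮n y′ (subst (_≤ y′) ℓ′≡ (proj₂ low′ y′ d)))
      N-below-ℓ′

    P-above-u′ : row lab s ℓ′ ≡ true → lab (suc s) (suc (suc u′)) ≡ true
    P-above-u′ row-blocked = P-intro (suc (suc u′)) (row-above-u′ _ (m<n⇒m<1+n (n<1+n u′)))
      (λ { y′ refl → ¬-not λ d → n≮n u′ (proj₂ up′ (suc u′) d) })
      below-free
      where
      below-free : ∀ y → y < suc (suc u′) → lab (suc s) y ≡ false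
      below-free y y<p with <-cmp y ℓ′
      ... | tri< y<ℓ′ _ _ = N-below-ℓ′ y y<ℓ′
      ... | tri≈ _ refl _ = row⇒N ℓ′ row-blocked
      ... | tri> _ _ ℓ′<y = N-inside y ℓ′<y (≤-pred y<p)

    private
      n : ℕ
      n = u′ ∸ ℓ′

      ℓ′+n≡u′ : ℓ′ + n ≡ u′
      ℓ′+n≡u′ = m+[n∸m]≡n ℓ′≤u′

      u′+1∸ℓ′≡n+1 : suc u′ ∸ ℓ′ ≡ suc n
      u′+1∸ℓ′≡n+1 = +-∸-assoc 1 ℓ′≤u′

    module _ {p : ℕ} (Pp : lab (suc s) p ≡ true) where

      diag-suc-cases : ∀ y → diag lab (suc s) y ≡ true → y ≡ p ⊎ (ℓ′ < y × y ≤ suc u′)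
      diag-suc-cases y d with diag-suc-elim lab s y d
      ... | inj₁ Py                = inj₁ (P-unique Py Pp)
      ... | inj₂ (y′ , refl , d′) = inj₂ (s≤s (proj₂ low′ y′ d′) , s≤s (proj₂ up′ y′ d′))

      isLow : ∀ v → v ≤ p → v ≤ suc ℓ′ → diag lab (suc s) v ≡ true → IsLow lab (suc s) v
      isLow v v≤p v≤ℓ′+1 dv = dv , λ y dy → case diag-suc-cases y dy of λ where
        (inj₁ refl)         → v≤p
        (inj₂ (ℓ′<y , _)) → ≤-trans v≤ℓ′+1 ℓ′<y

      isUp : ∀ w → p ≤ w → suc u′ ≤ w → diag lab (suc s) w ≡ true → IsUp lab (suc s) w
      isUp w p≤w u′<w dw = dw , λ y dy → case diag-suc-cases y dy of λ where
        (inj₁ refl)            → p≤w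
        (inj₂ (_ , y≤u′+1)) → ≤-trans y≤u′+1 u′<w

      row-suc-at-p : row lab (suc s) p ≡ true
      row-suc-at-p = cong (_∨ row lab s p) Pp

      row-suc-off-p : ∀ y → y ≢ p → row lab (suc s) y ≡ row lab s y
      row-suc-off-p y y≢p = row-suc-of-N lab s y (¬-not λ Py → y≢p (P-unique Py Pp))

      row-suc-end : suc u′ ≢ p → row lab (suc s) (suc ℓ′ + n) ≡ false
      row-suc-end u′+1≢p = begin
        row lab (suc s) (suc (ℓ′ + n)) ≡⟨ cong (λ y → row lab (suc s) (suc y)) ℓ′+n≡u′ ⟩
        row lab (suc s) (suc u′)       ≡⟨ row-suc-off-p (suc u′) u′+1≢p ⟩
        row lab s (suc u′)             ≡⟨ row-above-u′ (suc u′) ≤-refl ⟩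
        false                          ∎
        where open ≡-Reasoning

    module Free (row-free : row lab s ℓ′ ≡ false) where

      Pℓ′ : lab (suc s) ℓ′ ≡ true
      Pℓ′ = P-at-ℓ′ row-free

      low : IsLow lab (suc s) ℓ′
      low = isLow Pℓ′ ℓ′ ≤-refl (n≤1+n ℓ′) (P⇒diag lab (suc s) ℓ′ Pℓ′)

      up : IsUp lab (suc s) (suc u′)
      up = isUp Pℓ′ (suc u′) (m≤n⇒m≤1+n ℓ′≤u′) ≤-refl (∨-introʳ _ (proj₁ up′))

      update : wythoffUpdate (Sstr lab s ℓ′ u′) ≡ Sstr lab (suc s) ℓ′ (suc u′)
      update = begin
        wythoffUpdate (Sstr lab s ℓ′ u′)               ≡⟨ cong wythoffUpdate (Sstr≡segment lab s ℓ′ u′ refl) ⟩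
        wythoffUpdate (segment (row lab s) ℓ′ (suc n)) ≡⟨ wythoffUpdate-segment-false agree row-free
                                                             (row-suc-at-p Pℓ′) (row-suc-end Pℓ′ (>⇒≢ (s≤s ℓ′≤u′))) ⟩
        segment (row lab (suc s)) ℓ′ (suc (suc n))     ≡⟨ Sstr≡segment lab (suc s) ℓ′ (suc u′) u′+1∸ℓ′≡n+1 ⟨
        Sstr lab (suc s) ℓ′ (suc u′)                   ∎
        where
        open ≡-Reasoning
        agree : ∀ i → ℓ′ < i → i ≤ ℓ′ + n → row lab s i ≡ row lab (suc s) i
        agree i ℓ′<i _ = sym (row-suc-off-p Pℓ′ i (>⇒≢ ℓ′<i))

    module Blocked (row-blocked : row lab s ℓ′ ≡ true) where

      Pp : lab (suc s) (suc (suc u′)) ≡ true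
      Pp = P-above-u′ row-blocked

      low : IsLow lab (suc s) (suc ℓ′)
      low = isLow Pp (suc ℓ′) (s≤s (m≤n⇒m≤1+n ℓ′≤u′)) ≤-refl (∨-introʳ _ (proj₁ low′))

      up : IsUp lab (suc s) (suc (suc u′))
      up = isUp Pp (suc (suc u′)) ≤-refl (n≤1+n (suc u′)) (P⇒diag lab (suc s) _ Pp)

      update : wythoffUpdate (Sstr lab s ℓ′ u′) ≡ Sstr lab (suc s) (suc ℓ′) (suc (suc u′))
      update = begin
        wythoffUpdate (Sstr lab s ℓ′ u′)                 ≡⟨ cong wythoffUpdate (Sstr≡segment lab s ℓ′ u′ refl) ⟩
        wythoffUpdate (segment (row lab s) ℓ′ (suc n))   ≡⟨ wythoffUpdate-segment-true agree row-blocked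
                                                              (row-suc-end Pp (<⇒≢ (n<1+n (suc u′)))) top ⟩
        segment (row lab (suc s)) (suc ℓ′) (suc (suc n)) ≡⟨ Sstr≡segment lab (suc s) (suc ℓ′) (suc (suc u′)) u′+1∸ℓ′≡n+1 ⟨
        Sstr lab (suc s) (suc ℓ′) (suc (suc u′))         ∎
        where
        open ≡-Reasoning
        agree : ∀ i → ℓ′ < i → i ≤ ℓ′ + n → row lab s i ≡ row lab (suc s) i
        agree i _ i≤ℓ′+n = sym (row-suc-off-p Pp i (<⇒≢ (s≤s (m≤n⇒m≤1+n (subst (i ≤_) ℓ′+n≡u′ i≤ℓ′+n)))))

        top : row lab (suc s) (suc ℓ′ + suc n) ≡ true
        top = subst (λ y → row lab (suc s) y ≡ true)
                (cong suc (sym (trans (+-suc ℓ′ n) (cong suc ℓ′+n≡u′)))) (row-suc-at-p Pp)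

    wythoffUpdate-step : ∀ {ℓ u} → IsLow lab (suc s) ℓ → IsUp lab (suc s) u
      → wythoffUpdate (Sstr lab s ℓ′ u′) ≡ Sstr lab (suc s) ℓ u
    wythoffUpdate-step low up with row lab s ℓ′ in r
    ... | false rewrite IsLow-unique lab (suc s) low (Free.low r) | IsUp-unique lab (suc s) up (Free.up r) =
      Free.update r
    ... | true  rewrite IsLow-unique lab (suc s) low (Blocked.low r) | IsUp-unique lab (suc s) up (Blocked.up r) =
      Blocked.update r

lemma3 : (Ps Ns : List Pos) → (∀ p → p ∈ Ps → p ∉ Ns)
    → (mx : ℕ) → (∀ p → p ∈ Ps → proj₁ p < mx) → (∀ p → p ∈ Ns → proj₁ p < mx)
    → (lab : Labelling) → IsAlteredWythoffLabelling Ps Ns lab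
    → (t₀ : ℕ) → mx ≤ t₀ → (∀ t → t₀ ≤ t → Saturated lab t)
    → ∀ t → suc t₀ ≤ t
    → ∀ ℓ u ℓ′ u′ → IsLow lab t ℓ → IsUp lab t u
    → IsLow lab (t ∸ 1) ℓ′ → IsUp lab (t ∸ 1) u′
    → wythoffUpdate (Sstr lab (t ∸ 1) ℓ′ u′) ≡ Sstr lab t ℓ u
lemma3 Ps Ns _ mx Ps<mx Ns<mx lab isLab t₀ mx≤t₀ sat (suc s) (s≤s t₀≤s) ℓ u ℓ′ u′ low up low′ up′ =
  wythoffUpdate-step (sat s t₀≤s) (sat (suc s) (m≤n⇒m≤1+n t₀≤s)) low′ up′ low up
  where
  natural : ∀ {Qs y} → (∀ q → q ∈ Qs → proj₁ q < mx) → (suc s , y) ∉ Qs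
  natural bound q∈Qs = <⇒≱ (bound _ q∈Qs) (≤-trans mx≤t₀ (m≤n⇒m≤1+n t₀≤s))

  open NaturalColumn Ps Ns lab isLab s (λ _ → natural Ps<mx) (λ _ → natural Ns<mx)
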